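{- For every integer $m\ge1$, the number of spanning trees of any linear 2-tree with $m$ triangles is $F_{2m+2}$.
   Context: A 2-tree is built inductively from a triangle by repeatedly adding a new vertex adjacent to both endpoints of an existing edge. A linear 2-tree is a graph constructed inductively by starting with a triangle and repeatedly connecting a new vertex to both endpoints of an existing edge that includes a vertex of degree 2; equivalently, a 2-tree with exactly two vertices of degree 2. A linear 2-tree on $n$ vertices has $m=n-2$ triangles. $F_p$ denotes the Fibonacci numbers ($F_0=0,F_1=1,F_{p+1}=F_p+F_{p-1}$). -}

module Defs where

open import Data.Nat using (ℕ; zero; suc; _+_)
open import Data.Fin using (Fin; inject₁; fromℕ) renaming (_≟_ to _≟ᶠ_)
import Data.Fin as Fin
open import Data.Bool using (Bool; true; false)
open import Data.Product using (_×_; _,_; proj₁; proj₂; Σ)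
open import Data.Sum using (_⊎_)
open import Data.List using (List; []; _∷_; _++_; length; map; lookup)
open import Data.Vec using (Vec; []; _∷_; _[_]≔_)
  renaming (lookup to vlookup)
open import Data.List.Membership.Propositional using (_∈_)
open import Data.List.Relation.Unary.Unique.Propositional using (Unique)
open import Relation.Binary.PropositionalEquality using (_≡_)
open import Relation.Nullary using (¬_; does)
open import Function.Bundles using (_⇔_)

fib : ℕ → ℕ
fib zero = 0
fib (suc zero) = 1
fib (suc (suc p)) = fib (suc p) + fib p

-- A (finite) graph on vertex set Fin n is given by its list of edges.
Edge : ℕ → Set
Edge n = Fin n × Fin n

incident : ∀ {n} → Fin n → Edge n → Bool
incident u (a , b) with does (u ≟ᶠ a) | does (u ≟ᶠ b)
... | true  | _ = true
... | false | y = y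

deg : ∀ {n} → List (Edge n) → Fin n → ℕ
deg [] u = 0
deg (e ∷ es) u with incident u e
... | true  = suc (deg es u)
... | false = deg es u

-- Linear 2-trees, built inductively: start with a triangle on {0,1,2};
-- repeatedly add a new vertex (the new last vertex) adjacent to both
-- endpoints of an existing edge one of whose endpoints has degree 2.
data Linear2Tree : (n : ℕ) → List (Edge n) → Set where
  triangle : Linear2Tree 3
    ((Fin.zero , Fin.suc Fin.zero) ∷ (Fin.suc Fin.zero , Fin.suc (Fin.suc Fin.zero))
      ∷ (Fin.zero , Fin.suc (Fin.suc Fin.zero)) ∷ [])
  extend : ∀ {n} {E : List (Edge n)} → Linear2Tree n E →
    (i : Fin (length E)) →
    let u = proj₁ (lookup E i) ; v = proj₂ (lookup E i) in
    (deg E u ≡ 2 ⊎ deg E v ≡ 2) →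
    Linear2Tree (suc n)
      (map (λ e → inject₁ (proj₁ e) , inject₁ (proj₂ e)) E
        ++ ((inject₁ u , fromℕ n) ∷ (inject₁ v , fromℕ n) ∷ []))

data Reach {n} (E : List (Edge n)) : Fin n → Fin n → Set where
  here : ∀ {u} → Reach E u u
  fwd  : ∀ {u v w} → (u , v) ∈ E → Reach E v w → Reach E u w
  bwd  : ∀ {u v w} → (v , u) ∈ E → Reach E v w → Reach E u w

select : ∀ {n} (E : List (Edge n)) → Vec Bool (length E) → List (Edge n)
select [] [] = []
select (e ∷ es) (true ∷ S) = e ∷ select es S
select (e ∷ es) (false ∷ S) = select es S

-- Acyclic: no edge of S
-- lies on a cycle, i.e. removing any edge of S disconnects its endpoints.
IsSpanningTree : ∀ {n} (E : List (Edge n)) → Vec Bool (length E) → Set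
IsSpanningTree {n} E S =
  (∀ (u v : Fin n) → Reach (select E S) u v) ×
  (∀ (i : Fin (length E)) → vlookup S i ≡ true →
     ¬ Reach (select E (S [ i ]≔ false)) (proj₁ (lookup E i)) (proj₂ (lookup E i)))

NumSpanningTrees : ∀ {n} (E : List (Edge n)) → ℕ → Set
NumSpanningTrees E k =
  Σ (List (Vec Bool (length E))) λ L →
    Unique L × length L ≡ k × (∀ S → (S ∈ L) ⇔ IsSpanningTree E S)

-- Attach a new vertex w to the edge u v of a linear 2-tree G. A spanning tree of the new graph uses
-- exactly one of the edges u w, v w, and is then a spanning tree of G plus a pendant edge, or it uses
-- both, and then arises from a spanning tree of G through u v by replacing u v with the path u w v.
-- The edge u v contains one of the two degree-two "ends" of G, so we record, for both ends at once,
-- how many spanning trees use which of the two edges at that end. These counts form a fixed table in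
-- two consecutive Fibonacci numbers F₂ₖ, F₂ₖ₊₁; attaching a vertex advances the pair by two steps,
-- and summing the table over both ends gives F₂ₘ₊₂.

module Submission where

open import Defs
open import Data.Bool using (Bool; true; false; _∧_; _∨_; not; if_then_else_)
open import Data.Bool.Properties using (∧-assoc; ∧-comm; ∧-identityʳ; ∧-zeroʳ; ∨-identityʳ; ∨-zeroʳ; T-≡)
open import Data.Empty using (⊥-elim)
open import Data.Fin using (Fin; inject₁; fromℕ; toℕ; lower₁) renaming (_≟_ to _≟ᶠ_)
import Data.Fin as F
open import Data.Fin.Properties
  using (all?; suc-injective; fromℕ≢inject₁; inject₁-injective; toℕ-fromℕ; toℕ-inject₁-≢; lower₁-inject₁′)
open import Data.List using (List; []; _∷_; _++_; length; map; lookup; filterᵇ)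
open import Data.List.Membership.Propositional using (_∈_)
open import Data.List.Membership.Propositional.Properties
  using (∈-map⁺; ∈-map⁻; ∈-++⁺ˡ; ∈-++⁺ʳ; ∈-++⁻; ∈-filter⁺; ∈-filter⁻)
open import Data.List.Relation.Binary.Disjoint.Propositional using (Disjoint)
open import Data.List.Relation.Unary.All using (All; []; _∷_)
open import Data.List.Relation.Unary.Unique.Propositional using (Unique; []; _∷_)
import Data.List.Relation.Unary.Unique.Propositional.Properties as Unique
open import Data.List.Relation.Unary.Any using (here; there)
open import Data.Nat using (ℕ; zero; suc; _+_; _*_; _≤_; z≤n; s≤s)
import Data.Nat as ℕ
import Data.Bool as Bool
open import Data.Nat.Tactic.RingSolver using (solve-∀)
open import Data.Nat.Properties
  using (≤-refl; ≤-trans; m<m+n; m≤m+n; m≤n+m; +-identityʳ; +-assoc; +-suc; +-comm; *-suc)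
open import Data.Product using (_×_; _,_; proj₁; proj₂; ∃-syntax)
open import Data.Sum using (_⊎_; inj₁; inj₂)
open import Data.Vec using (Vec; []; _∷_; _[_]≔_) renaming (lookup to vlookup)
open import Data.Vec.Properties using (lookup∘update; lookup∘update′; []≔-idempotent; []≔-lookup)
open import Function.Base using (id)
open import Function.Bundles using (_⇔_; mk⇔; Equivalence)
open import Relation.Binary.PropositionalEquality
open import Relation.Nullary using (¬_; does; yes; no)
open import Relation.Nullary.Decidable
  using (Dec; dec-true; dec-false; True; toWitness; ¬?; _×-dec_; _⊎-dec_; _→-dec_)

-- Paths, edge subsets and counting

Reach-trans : ∀ {n} {E : List (Edge n)} {x y z} → Reach E x y → Reach E y z → Reach E x z
Reach-trans here q = q
Reach-trans (fwd e p) q = fwd e (Reach-trans p q)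
Reach-trans (bwd e p) q = bwd e (Reach-trans p q)

Reach-sym : ∀ {n} {E : List (Edge n)} {x y} → Reach E x y → Reach E y x
Reach-sym here = here
Reach-sym (fwd e p) = Reach-trans (Reach-sym p) (bwd e here)
Reach-sym (bwd e p) = Reach-trans (Reach-sym p) (fwd e here)

Reach-edge : ∀ {n} {E : List (Edge n)} {x y} → (x , y) ∈ E → Reach E x y
Reach-edge e = fwd e here

Reach-map : ∀ {n n′} {E : List (Edge n)} {E′ : List (Edge n′)} (φ : Fin n → Fin n′) →
  (∀ {a b} → (a , b) ∈ E → Reach E′ (φ a) (φ b)) →
  ∀ {x y} → Reach E x y → Reach E′ (φ x) (φ y)
Reach-map φ h here = here
Reach-map φ h (fwd e p) = Reach-trans (h e) (Reach-map φ h p)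
Reach-map φ h (bwd e p) = Reach-trans (Reach-sym (h e)) (Reach-map φ h p)

Reach-invariant : ∀ {n} {E : List (Edge n)} {A : Set} (c : Fin n → A) →
  (∀ {a b} → (a , b) ∈ E → c a ≡ c b) → ∀ {x y} → Reach E x y → c x ≡ c y
Reach-invariant c h here = refl
Reach-invariant c h (fwd e p) = trans (h e) (Reach-invariant c h p)
Reach-invariant c h (bwd e p) = trans (sym (h e)) (Reach-invariant c h p)

connected-via : ∀ {n} {E : List (Edge n)} (z : Fin n) → (∀ x → Reach E x z) → ∀ x y → Reach E x y
connected-via z to-z x y = Reach-trans (to-z x) (Reach-sym (to-z y))

select-∈⁻ : ∀ {n} (E : List (Edge n)) (S : Vec Bool (length E)) {e} → e ∈ select E S →
  ∃[ j ] vlookup S j ≡ true × lookup E j ≡ e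
select-∈⁻ [] [] ()
select-∈⁻ (e ∷ E) (true ∷ S) (here refl) = F.zero , refl , refl
select-∈⁻ (e ∷ E) (true ∷ S) (there m) with select-∈⁻ E S m
... | j , Sj , Ej = F.suc j , Sj , Ej
select-∈⁻ (e ∷ E) (false ∷ S) m with select-∈⁻ E S m
... | j , Sj , Ej = F.suc j , Sj , Ej

select-∈⁺ : ∀ {n} (E : List (Edge n)) (S : Vec Bool (length E)) j {e} →
  vlookup S j ≡ true → lookup E j ≡ e → e ∈ select E S
select-∈⁺ (e ∷ E) (true ∷ S) F.zero Sj refl = here refl
select-∈⁺ (e ∷ E) (true ∷ S) (F.suc j) Sj Ej = there (select-∈⁺ E S j Sj Ej)
select-∈⁺ (e ∷ E) (false ∷ S) (F.suc j) Sj Ej = select-∈⁺ E S j Sj Ej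

select-mono : ∀ {n} (E : List (Edge n)) {S₁ S₂ : Vec Bool (length E)} →
  (∀ j → vlookup S₁ j ≡ true → vlookup S₂ j ≡ true) → ∀ {e} → e ∈ select E S₁ → e ∈ select E S₂
select-mono E {S₁} {S₂} sub m with select-∈⁻ E S₁ m
... | j , Sj , Ej = select-∈⁺ E S₂ j (sub j Sj) Ej

false≢true : false ≢ true
false≢true ()

lookup-removed : ∀ {N} (S : Vec Bool N) i j →
  vlookup (S [ i ]≔ false) j ≡ true → j ≢ i × vlookup S j ≡ true
lookup-removed S i j Sj with j ≟ᶠ i
... | yes refl = ⊥-elim (false≢true (trans (sym (lookup∘update i S false)) Sj))
... | no j≢i = j≢i , trans (sym (lookup∘update′ j≢i S false)) Sj

remove-insert : ∀ {N} (S : Vec Bool N) i b → vlookup S i ≡ b → (S [ i ]≔ not b) [ i ]≔ b ≡ S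
remove-insert S i b Si = trans ([]≔-idempotent S i) (trans (cong (S [ i ]≔_) (sym Si)) ([]≔-lookup S i))

separated : ∀ {n} {G : List (Edge n)} (z : Fin n) →
  (∀ {a b} → (a , b) ∈ G → does (a ≟ᶠ z) ≡ does (b ≟ᶠ z)) →
  ∀ {x y} → does (x ≟ᶠ z) ≢ does (y ≟ᶠ z) → ¬ Reach G x y
separated z respects x≁y r = x≁y (Reach-invariant (λ a → does (a ≟ᶠ z)) respects r)

Unique-map⁺-on : ∀ {A B : Set} (f : A → B) {xs : List A} →
  (∀ {x y} → x ∈ xs → y ∈ xs → f x ≡ f y → x ≡ y) → Unique xs → Unique (map f xs)
Unique-map⁺-on f {[]} injective [] = []
Unique-map⁺-on f {x ∷ xs} injective (x∉xs ∷ unique) =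
  distinct xs x∉xs (λ m → m) ∷ Unique-map⁺-on f (λ m₁ m₂ → injective (there m₁) (there m₂)) unique
  where
  distinct : ∀ zs → All (x ≢_) zs → (∀ {z} → z ∈ zs → z ∈ xs) → All (f x ≢_) (map f zs)
  distinct [] [] _ = []
  distinct (z ∷ zs) (x≢z ∷ rest) zs⊆xs =
    (λ fx≡fz → x≢z (injective (here refl) (there (zs⊆xs (here refl))) fx≡fz))
      ∷ distinct zs rest (λ m → zs⊆xs (there m))

count : ∀ {A : Set} → (A → Bool) → List A → ℕ
count p [] = 0
count p (x ∷ xs) = if p x then suc (count p xs) else count p xs

module _ {A : Set} where

  count-++ : ∀ (p : A → Bool) xs ys → count p (xs ++ ys) ≡ count p xs + count p ys
  count-++ p [] ys = refl
  count-++ p (x ∷ xs) ys with p x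
  ... | true = cong suc (count-++ p xs ys)
  ... | false = count-++ p xs ys

  count-map : ∀ {B : Set} (p : B → Bool) (f : A → B) xs → count p (map f xs) ≡ count (λ x → p (f x)) xs
  count-map p f [] = refl
  count-map p f (x ∷ xs) with p (f x)
  ... | true = cong suc (count-map p f xs)
  ... | false = count-map p f xs

  count-cong : ∀ {p q : A → Bool} xs → (∀ x → p x ≡ q x) → count p xs ≡ count q xs
  count-cong [] p≗q = refl
  count-cong {q = q} (x ∷ xs) p≗q rewrite p≗q x with q x
  ... | true = cong suc (count-cong xs p≗q)
  ... | false = count-cong xs p≗q

  count-none : ∀ {p : A → Bool} xs → (∀ x → p x ≡ false) → count p xs ≡ 0
  count-none [] _ = refl
  count-none (x ∷ xs) all-false rewrite all-false x = count-none xs all-false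

  count-filterᵇ : ∀ (p q : A → Bool) xs → count p (filterᵇ q xs) ≡ count (λ x → q x ∧ p x) xs
  count-filterᵇ p q [] = refl
  count-filterᵇ p q (x ∷ xs) with q x
  ... | false = count-filterᵇ p q xs
  ... | true with p x
  ... | true = cong suc (count-filterᵇ p q xs)
  ... | false = count-filterᵇ p q xs

  length≡count : ∀ (xs : List A) → length xs ≡ count (λ _ → true) xs
  length≡count [] = refl
  length≡count (x ∷ xs) = cong suc (length≡count xs)

infix 4 _==_
_==_ : Bool → Bool → Bool
b == true = b
b == false = not b

Σᵇ : (Bool → ℕ) → ℕ
Σᵇ f = f true + f false

Σᵇ-cong : ∀ {f g : Bool → ℕ} → (∀ b → f b ≡ g b) → Σᵇ f ≡ Σᵇ g
Σᵇ-cong f≗g = cong₂ _+_ (f≗g true) (f≗g false)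

count-by : ∀ {A : Set} (g p : A → Bool) xs → count p xs ≡ Σᵇ (λ b → count (λ x → (g x == b) ∧ p x) xs)
count-by g p [] = refl
count-by g p (x ∷ xs) with g x | p x
... | true | true = cong suc (count-by g p xs)
... | true | false = count-by g p xs
... | false | true = trans (cong suc (count-by g p xs)) (sym (+-suc _ _))
... | false | false = count-by g p xs

∧-swapˡ : ∀ a b c → a ∧ (b ∧ c) ≡ b ∧ (a ∧ c)
∧-swapˡ a b c = trans (sym (∧-assoc a b c)) (trans (cong (_∧ c) (∧-comm a b)) (∧-assoc b a c))

∀-Bool? : ∀ {P : Bool → Set} → (∀ b → Dec (P b)) → Dec (∀ b → P b)
∀-Bool? P? with P? true | P? false
... | yes pt | yes pf = yes λ { true → pt ; false → pf }
... | no ¬pt | _ = no λ all → ¬pt (all true)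
... | yes _ | no ¬pf = no λ all → ¬pf (all false)

EdgesAreBridges : ∀ {n} (E : List (Edge n)) → Vec Bool (length E) → Set
EdgesAreBridges E S =
  ∀ j → vlookup S j ≡ true → ¬ Reach (select E (S [ j ]≔ false)) (proj₁ (lookup E j)) (proj₂ (lookup E j))

SpanningTreeList : ∀ {n} (E : List (Edge n)) → List (Vec Bool (length E)) → Set
SpanningTreeList E L = Unique L × (∀ S → (S ∈ L) ⇔ IsSpanningTree E S)

liftEdge : ∀ {n} → Edge n → Edge (suc n)
liftEdge e = inject₁ (proj₁ e) , inject₁ (proj₂ e)

fromℕ-or-inject₁ : ∀ {n} (j : Fin (suc n)) → j ≡ fromℕ n ⊎ ∃[ y ] j ≡ inject₁ y
fromℕ-or-inject₁ {zero} F.zero = inj₁ refl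
fromℕ-or-inject₁ {suc n} F.zero = inj₂ (F.zero , refl)
fromℕ-or-inject₁ {suc n} (F.suc j) with fromℕ-or-inject₁ j
... | inj₁ refl = inj₁ refl
... | inj₂ (y , refl) = inj₂ (F.suc y , refl)

inject₁≢fromℕ : ∀ {n} (y : Fin n) → inject₁ y ≢ fromℕ n
inject₁≢fromℕ y eq = fromℕ≢inject₁ (sym eq)

-- Contracts the new vertex fromℕ n onto d.
collapse : ∀ {n} → Fin n → Fin (suc n) → Fin n
collapse {n} d j with n ℕ.≟ toℕ j
... | yes _ = d
... | no n≢j = lower₁ j n≢j

collapse-inject₁ : ∀ {n} (d y : Fin n) → collapse d (inject₁ y) ≡ y
collapse-inject₁ {n} d y with n ℕ.≟ toℕ (inject₁ y)
... | yes n≡y = ⊥-elim (toℕ-inject₁-≢ y n≡y)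
... | no n≢y = lower₁-inject₁′ y n≢y

collapse-fromℕ : ∀ {n} (d : Fin n) → collapse d (fromℕ n) ≡ d
collapse-fromℕ {n} d with n ℕ.≟ toℕ (fromℕ n)
... | yes _ = refl
... | no n≢n = ⊥-elim (n≢n (sym (toℕ-fromℕ n)))

module _ {n : ℕ} where

  Reach-lift : ∀ {F : List (Edge n)} (X : List (Edge (suc n))) {a b} → Reach F a b →
    Reach (map liftEdge F ++ X) (inject₁ a) (inject₁ b)
  Reach-lift {F} X = Reach-map inject₁ (λ e → Reach-edge (∈-++⁺ˡ (∈-map⁺ liftEdge e)))

  Reach-collapse : ∀ {F F′ : List (Edge n)} (X : List (Edge (suc n))) (d : Fin n) →
    (∀ {e} → e ∈ F → e ∈ F′) →
    (∀ {a b} → (a , b) ∈ X → Reach F′ (collapse d a) (collapse d b)) →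
    ∀ {x y} → Reach (map liftEdge F ++ X) (inject₁ x) (inject₁ y) → Reach F′ x y
  Reach-collapse {F} {F′} X d F⊆F′ X-ok {x} {y} r =
    subst₂ (Reach F′) (collapse-inject₁ d x) (collapse-inject₁ d y) (Reach-map (collapse d) step r)
    where
    step : ∀ {a b} → (a , b) ∈ map liftEdge F ++ X → Reach F′ (collapse d a) (collapse d b)
    step e with ∈-++⁻ (map liftEdge F) e
    ... | inj₂ eX = X-ok eX
    ... | inj₁ eF with ∈-map⁻ liftEdge eF
    ... | (a , b) , e₀ , refl rewrite collapse-inject₁ d a | collapse-inject₁ d b = Reach-edge (F⊆F′ e₀)

  collapse-edge : ∀ {F′ : List (Edge n)} (d c : Fin n) → Reach F′ c d →
    Reach F′ (collapse d (inject₁ c)) (collapse d (fromℕ n))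
  collapse-edge {F′} d c r = subst₂ (Reach F′) (sym (collapse-inject₁ d c)) (sym (collapse-fromℕ d)) r

  fromℕ-isolated : ∀ (F : List (Edge n)) (c : Fin n) → ¬ Reach (map liftEdge F ++ []) (inject₁ c) (fromℕ n)
  fromℕ-isolated F c r =
    false≢true (trans (sym (isNew-inject₁ c)) (trans (Reach-invariant isNew old-edges r) isNew-fromℕ))
    where
    isNew : Fin (suc n) → Bool
    isNew j = does (j ≟ᶠ fromℕ n)
    isNew-inject₁ : ∀ y → isNew (inject₁ y) ≡ false
    isNew-inject₁ y with inject₁ y ≟ᶠ fromℕ n
    ... | yes eq = ⊥-elim (inject₁≢fromℕ y eq)
    ... | no _ = refl
    isNew-fromℕ : isNew (fromℕ n) ≡ true
    isNew-fromℕ with fromℕ n ≟ᶠ fromℕ n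
    ... | yes _ = refl
    ... | no ne = ⊥-elim (ne refl)
    old-edges : ∀ {a b} → (a , b) ∈ map liftEdge F ++ [] → isNew a ≡ isNew b
    old-edges e with ∈-++⁻ (map liftEdge F) e
    ... | inj₂ ()
    ... | inj₁ eF with ∈-map⁻ liftEdge eF
    ... | (a , b) , _ , refl = trans (isNew-inject₁ a) (sym (isNew-inject₁ b))

incident-∨ : ∀ {n} (y : Fin n) e → incident y e ≡ does (y ≟ᶠ proj₁ e) ∨ does (y ≟ᶠ proj₂ e)
incident-∨ y (a , b) with does (y ≟ᶠ a) | does (y ≟ᶠ b)
... | true | _ = refl
... | false | _ = refl

incident⇒endpoint : ∀ {n} (y : Fin n) e → incident y e ≡ true → y ≡ proj₁ e ⊎ y ≡ proj₂ e
incident⇒endpoint y e inc with y ≟ᶠ proj₁ e | y ≟ᶠ proj₂ e | incident-∨ y e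
... | yes y≡a | _ | _ = inj₁ y≡a
... | no _ | yes y≡b | _ = inj₂ y≡b
... | no _ | no _ | eq = ⊥-elim (false≢true (trans (sym eq) inc))

incident-proj₁ : ∀ {n} (e : Edge n) → incident (proj₁ e) e ≡ true
incident-proj₁ e rewrite incident-∨ (proj₁ e) e | dec-true (proj₁ e ≟ᶠ proj₁ e) refl = refl

incident-proj₂ : ∀ {n} (e : Edge n) → incident (proj₂ e) e ≡ true
incident-proj₂ e rewrite incident-∨ (proj₂ e) e | dec-true (proj₂ e ≟ᶠ proj₂ e) refl = ∨-zeroʳ _

does-inject₁ : ∀ {n} (y z : Fin n) → does (inject₁ y ≟ᶠ inject₁ z) ≡ does (y ≟ᶠ z)
does-inject₁ y z with y ≟ᶠ z
... | yes refl = dec-true (inject₁ y ≟ᶠ inject₁ y) refl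
... | no y≢z = dec-false (inject₁ y ≟ᶠ inject₁ z) (λ eq → y≢z (inject₁-injective eq))

does-inject₁-fromℕ : ∀ {n} (y : Fin n) → does (inject₁ y ≟ᶠ fromℕ n) ≡ false
does-inject₁-fromℕ {n} y = dec-false (inject₁ y ≟ᶠ fromℕ n) (inject₁≢fromℕ y)

does-fromℕ-inject₁ : ∀ {n} (y : Fin n) → does (fromℕ n ≟ᶠ inject₁ y) ≡ false
does-fromℕ-inject₁ {n} y = dec-false (fromℕ n ≟ᶠ inject₁ y) (fromℕ≢inject₁)

incident-lift : ∀ {n} (y : Fin n) e → incident (inject₁ y) (liftEdge e) ≡ incident y e
incident-lift y e
  rewrite incident-∨ (inject₁ y) (liftEdge e) | incident-∨ y e
        | does-inject₁ y (proj₁ e) | does-inject₁ y (proj₂ e) = refl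

incident-fromℕ-lift : ∀ {n} (e : Edge n) → incident (fromℕ n) (liftEdge e) ≡ false
incident-fromℕ-lift {n} e
  rewrite incident-∨ (fromℕ n) (liftEdge e) | does-fromℕ-inject₁ (proj₁ e) | does-fromℕ-inject₁ (proj₂ e) = refl

incident-inject₁-new : ∀ {n} (y c : Fin n) → incident (inject₁ y) (inject₁ c , fromℕ n) ≡ does (y ≟ᶠ c)
incident-inject₁-new {n} y c
  rewrite incident-∨ (inject₁ y) (inject₁ c , fromℕ n) | does-inject₁ y c | does-inject₁-fromℕ y = ∨-identityʳ _

𝟙 : Bool → ℕ
𝟙 b = if b then 1 else 0

deg-∷ : ∀ {n} e (es : List (Edge n)) y → deg (e ∷ es) y ≡ 𝟙 (incident y e) + deg es y
deg-∷ e es y with incident y e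
... | true = refl
... | false = refl

deg-++ : ∀ {n} (xs ys : List (Edge n)) y → deg (xs ++ ys) y ≡ deg xs y + deg ys y
deg-++ [] ys y = refl
deg-++ (e ∷ xs) ys y rewrite deg-∷ e (xs ++ ys) y | deg-∷ e xs y | deg-++ xs ys y =
  sym (+-assoc (𝟙 (incident y e)) _ _)

deg-lift : ∀ {n} (E : List (Edge n)) y → deg (map liftEdge E) (inject₁ y) ≡ deg E y
deg-lift [] y = refl
deg-lift (e ∷ E) y rewrite deg-∷ (liftEdge e) (map liftEdge E) (inject₁ y) | deg-∷ e E y
                         | incident-lift y e | deg-lift E y = refl

deg-lift-fromℕ : ∀ {n} (E : List (Edge n)) → deg (map liftEdge E) (fromℕ n) ≡ 0
deg-lift-fromℕ [] = refl
deg-lift-fromℕ (e ∷ E) rewrite deg-∷ (liftEdge e) (map liftEdge E) (fromℕ _) | incident-fromℕ-lift e =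
  deg-lift-fromℕ E

module Extension {n : ℕ} (ys : List (Edge (suc n))) where

  join : ∀ (E : List (Edge n)) →
    Vec Bool (length E) → Vec Bool (length ys) → Vec Bool (length (map liftEdge E ++ ys))
  join [] [] T = T
  join (_ ∷ E) (s ∷ S) T = s ∷ join E S T

  join-surjective : ∀ (E : List (Edge n)) (S′ : Vec Bool (length (map liftEdge E ++ ys))) →
    ∃[ S ] ∃[ T ] S′ ≡ join E S T
  join-surjective [] T = [] , T , refl
  join-surjective (_ ∷ E) (s ∷ S′) with join-surjective E S′
  ... | S , T , refl = s ∷ S , T , refl

  join-injective : ∀ (E : List (Edge n)) {S₁ S₂ T₁ T₂} → join E S₁ T₁ ≡ join E S₂ T₂ → S₁ ≡ S₂ × T₁ ≡ T₂
  join-injective [] {[]} {[]} refl = refl , refl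
  join-injective (_ ∷ E) {_ ∷ _} {_ ∷ _} eq with join-injective E (cong Data.Vec.tail eq) | cong Data.Vec.head eq
  ... | refl , refl | refl = refl , refl

  select-join : ∀ (E : List (Edge n)) S T →
    select (map liftEdge E ++ ys) (join E S T) ≡ map liftEdge (select E S) ++ select ys T
  select-join [] [] T = refl
  select-join (e ∷ E) (true ∷ S) T = cong (liftEdge e ∷_) (select-join E S T)
  select-join (e ∷ E) (false ∷ S) T = select-join E S T

  oldIx : ∀ (E : List (Edge n)) → Fin (length E) → Fin (length (map liftEdge E ++ ys))
  oldIx (_ ∷ E) F.zero = F.zero
  oldIx (_ ∷ E) (F.suc i) = F.suc (oldIx E i)

  newIx : ∀ (E : List (Edge n)) → Fin (length ys) → Fin (length (map liftEdge E ++ ys))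
  newIx [] k = k
  newIx (_ ∷ E) k = F.suc (newIx E k)

  oldIx-or-newIx : ∀ (E : List (Edge n)) (j : Fin (length (map liftEdge E ++ ys))) →
    (∃[ i ] j ≡ oldIx E i) ⊎ (∃[ k ] j ≡ newIx E k)
  oldIx-or-newIx [] j = inj₂ (j , refl)
  oldIx-or-newIx (_ ∷ E) F.zero = inj₁ (F.zero , refl)
  oldIx-or-newIx (_ ∷ E) (F.suc j) with oldIx-or-newIx E j
  ... | inj₁ (i , refl) = inj₁ (F.suc i , refl)
  ... | inj₂ (k , refl) = inj₂ (k , refl)

  oldIx≢newIx : ∀ (E : List (Edge n)) i k → oldIx E i ≢ newIx E k
  oldIx≢newIx (_ ∷ E) (F.suc i) k eq = oldIx≢newIx E i k (suc-injective eq)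

  lookup-oldIx : ∀ (E : List (Edge n)) i → lookup (map liftEdge E ++ ys) (oldIx E i) ≡ liftEdge (lookup E i)
  lookup-oldIx (_ ∷ E) F.zero = refl
  lookup-oldIx (_ ∷ E) (F.suc i) = lookup-oldIx E i

  lookup-newIx : ∀ (E : List (Edge n)) k → lookup (map liftEdge E ++ ys) (newIx E k) ≡ lookup ys k
  lookup-newIx [] k = refl
  lookup-newIx (_ ∷ E) k = lookup-newIx E k

  join-oldIx : ∀ (E : List (Edge n)) S T i → vlookup (join E S T) (oldIx E i) ≡ vlookup S i
  join-oldIx (_ ∷ E) (s ∷ S) T F.zero = refl
  join-oldIx (_ ∷ E) (s ∷ S) T (F.suc i) = join-oldIx E S T i

  join-newIx : ∀ (E : List (Edge n)) S T k → vlookup (join E S T) (newIx E k) ≡ vlookup T k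
  join-newIx [] [] T k = refl
  join-newIx (_ ∷ E) (s ∷ S) T k = join-newIx E S T k

  join-update-oldIx : ∀ (E : List (Edge n)) S T i b → join E S T [ oldIx E i ]≔ b ≡ join E (S [ i ]≔ b) T
  join-update-oldIx (_ ∷ E) (s ∷ S) T F.zero b = refl
  join-update-oldIx (_ ∷ E) (s ∷ S) T (F.suc i) b = cong (s ∷_) (join-update-oldIx E S T i b)

  join-update-newIx : ∀ (E : List (Edge n)) S T k b → join E S T [ newIx E k ]≔ b ≡ join E S (T [ k ]≔ b)
  join-update-newIx [] [] T k b = refl
  join-update-newIx (_ ∷ E) (s ∷ S) T k b = cong (s ∷_) (join-update-newIx E S T k b)

  record SplitSpanningTree (E : List (Edge n)) (S : Vec Bool (length E)) (T : Vec Bool (length ys)) : Set where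
    field
      connected : ∀ x y → Reach (map liftEdge (select E S) ++ select ys T) x y
      old-bridge : ∀ j → vlookup S j ≡ true →
        ¬ Reach (map liftEdge (select E (S [ j ]≔ false)) ++ select ys T)
                (inject₁ (proj₁ (lookup E j))) (inject₁ (proj₂ (lookup E j)))
      new-bridge : ∀ k → vlookup T k ≡ true →
        ¬ Reach (map liftEdge (select E S) ++ select ys (T [ k ]≔ false))
                (proj₁ (lookup ys k)) (proj₂ (lookup ys k))

  module _ (E : List (Edge n)) (S : Vec Bool (length E)) (T : Vec Bool (length ys)) where

    private
      E⁺ : List (Edge (suc n))
      E⁺ = map liftEdge E ++ ys

      Reach-cast : ∀ {G₁ G₂ : List (Edge (suc n))} {e₁ e₂ : Edge (suc n)} → G₁ ≡ G₂ → e₁ ≡ e₂ →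
        Reach G₁ (proj₁ e₁) (proj₂ e₁) → Reach G₂ (proj₁ e₂) (proj₂ e₂)
      Reach-cast refl refl r = r

      remove-oldIx : ∀ i → select E⁺ (join E S T [ oldIx E i ]≔ false)
                           ≡ map liftEdge (select E (S [ i ]≔ false)) ++ select ys T
      remove-oldIx i = trans (cong (select E⁺) (join-update-oldIx E S T i false)) (select-join E _ T)

      remove-newIx : ∀ k → select E⁺ (join E S T [ newIx E k ]≔ false)
                           ≡ map liftEdge (select E S) ++ select ys (T [ k ]≔ false)
      remove-newIx k = trans (cong (select E⁺) (join-update-newIx E S T k false)) (select-join E S _)

    join-spanningTree⁺ : SplitSpanningTree E S T → IsSpanningTree E⁺ (join E S T)
    join-spanningTree⁺ P = connected′ , bridge
      where
      open SplitSpanningTree P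
      connected′ : ∀ x y → Reach (select E⁺ (join E S T)) x y
      connected′ x y = subst (λ G → Reach G x y) (sym (select-join E S T)) (connected x y)
      bridge : EdgesAreBridges E⁺ (join E S T)
      bridge j Sj with oldIx-or-newIx E j
      ... | inj₁ (i , refl) = λ r → old-bridge i (trans (sym (join-oldIx E S T i)) Sj)
                                      (Reach-cast (remove-oldIx i) (lookup-oldIx E i) r)
      ... | inj₂ (k , refl) = λ r → new-bridge k (trans (sym (join-newIx E S T k)) Sj)
                                      (Reach-cast (remove-newIx k) (lookup-newIx E k) r)

    join-spanningTree⁻ : IsSpanningTree E⁺ (join E S T) → SplitSpanningTree E S T
    join-spanningTree⁻ (connected′ , bridge) = record
      { connected = λ x y → subst (λ G → Reach G x y) (select-join E S T) (connected′ x y)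
      ; old-bridge = λ i Si r → bridge (oldIx E i) (trans (join-oldIx E S T i) Si)
                                  (Reach-cast (sym (remove-oldIx i)) (sym (lookup-oldIx E i)) r)
      ; new-bridge = λ k Tk r → bridge (newIx E k) (trans (join-newIx E S T k) Tk)
                                  (Reach-cast (sym (remove-newIx k)) (sym (lookup-newIx E k)) r)
      }

-- Attaching a vertex to an edge

module Attach {n : ℕ} (E : List (Edge n)) (i : Fin (length E)) where

  u v : Fin n
  u = proj₁ (lookup E i)
  v = proj₂ (lookup E i)

  w : Fin (suc n)
  w = fromℕ n

  ys : List (Edge (suc n))
  ys = (inject₁ u , w) ∷ (inject₁ v , w) ∷ []

  E⁺ : List (Edge (suc n))
  E⁺ = map liftEdge E ++ ys

  open Extension ys public

  TF FT TT : Vec Bool 2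
  TF = true ∷ false ∷ []
  FT = false ∷ true ∷ []
  TT = true ∷ true ∷ []

  private
    w-edge : ∀ {F : List (Edge n)} {X : List (Edge (suc n))} c →
      (inject₁ c , w) ∈ X → Reach (map liftEdge F ++ X) w (inject₁ c)
    w-edge {F} c e = bwd (∈-++⁺ʳ (map liftEdge F) e) here

    u-w-v : ∀ {F : List (Edge n)} → Reach (map liftEdge F ++ ys) (inject₁ u) (inject₁ v)
    u-w-v {F} = Reach-trans (Reach-sym (w-edge u (here refl))) (w-edge {F} v (there (here refl)))

  module Pendant (c : Fin n) where

    private
      collapse-ok : ∀ {F′ : List (Edge n)} {a b} → (a , b) ∈ (inject₁ c , w) ∷ [] →
        Reach F′ (collapse c a) (collapse c b)
      collapse-ok (here refl) = collapse-edge c c here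

    pendant-connected : ∀ S → IsSpanningTree E S →
      ∀ x y → Reach (map liftEdge (select E S) ++ (inject₁ c , w) ∷ []) x y
    pendant-connected S (connected , _) = connected-via (inject₁ c) to-c
      where
      to-c : ∀ x → Reach (map liftEdge (select E S) ++ (inject₁ c , w) ∷ []) x (inject₁ c)
      to-c x with fromℕ-or-inject₁ x
      ... | inj₁ refl = w-edge c (here refl)
      ... | inj₂ (y , refl) = Reach-lift _ (connected y c)

    pendant-old-bridge : ∀ S → IsSpanningTree E S → ∀ j → vlookup S j ≡ true →
      ¬ Reach (map liftEdge (select E (S [ j ]≔ false)) ++ (inject₁ c , w) ∷ [])
              (inject₁ (proj₁ (lookup E j))) (inject₁ (proj₂ (lookup E j)))
    pendant-old-bridge S (_ , bridge) j Sj r = bridge j Sj (Reach-collapse _ c (λ e → e) collapse-ok r)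

    pendant⁻ : ∀ S T → select ys T ≡ (inject₁ c , w) ∷ [] → SplitSpanningTree E S T → IsSpanningTree E S
    pendant⁻ S T ys-T P = connected′ , bridge
      where
      open SplitSpanningTree P
      connected′ : ∀ x y → Reach (select E S) x y
      connected′ x y = Reach-collapse _ c (λ e → e) collapse-ok
        (subst (λ X → Reach (map liftEdge (select E S) ++ X) (inject₁ x) (inject₁ y)) ys-T (connected _ _))
      bridge : EdgesAreBridges E S
      bridge j Sj r = old-bridge j Sj
        (subst (λ X → Reach (map liftEdge (select E (S [ j ]≔ false)) ++ X) _ _) (sym ys-T) (Reach-lift _ r))

  open Pendant

  pendantᵘ⁺ : ∀ S → IsSpanningTree E S → SplitSpanningTree E S TF
  pendantᵘ⁺ S tree = record
    { connected = pendant-connected u S tree ; old-bridge = pendant-old-bridge u S tree ; new-bridge = bridge }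
    where
    bridge : ∀ k → vlookup TF k ≡ true → ¬ Reach (map liftEdge (select E S) ++ select ys (TF [ k ]≔ false))
                                                  (proj₁ (lookup ys k)) (proj₂ (lookup ys k))
    bridge F.zero _ = fromℕ-isolated (select E S) u
    bridge (F.suc F.zero) ()

  pendantᵛ⁺ : ∀ S → IsSpanningTree E S → SplitSpanningTree E S FT
  pendantᵛ⁺ S tree = record
    { connected = pendant-connected v S tree ; old-bridge = pendant-old-bridge v S tree ; new-bridge = bridge }
    where
    bridge : ∀ k → vlookup FT k ≡ true → ¬ Reach (map liftEdge (select E S) ++ select ys (FT [ k ]≔ false))
                                                  (proj₁ (lookup ys k)) (proj₂ (lookup ys k))
    bridge F.zero ()
    bridge (F.suc F.zero) _ = fromℕ-isolated (select E S) v

  w-not-isolated : ∀ S → ¬ SplitSpanningTree E S (false ∷ false ∷ [])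
  w-not-isolated S P = fromℕ-isolated (select E S) u (SplitSpanningTree.connected P (inject₁ u) w)

  -- Trees using both new edges: the path u w v takes over the role of the edge i.
  private
    detour : ∀ {S₁ S₂ : Vec Bool (length E)} → (∀ k → vlookup S₁ k ≡ true → k ≡ i ⊎ vlookup S₂ k ≡ true) →
      ∀ {x y} → Reach (select E S₁) x y → Reach (map liftEdge (select E S₂) ++ ys) (inject₁ x) (inject₁ y)
    detour {S₁} {S₂} S₁⊆S₂+i = Reach-map inject₁ step
      where
      step : ∀ {a b} → (a , b) ∈ select E S₁ → Reach (map liftEdge (select E S₂) ++ ys) (inject₁ a) (inject₁ b)
      step e with select-∈⁻ E S₁ e
      ... | k , S₁k , refl with S₁⊆S₂+i k S₁k
      ... | inj₁ refl = u-w-v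
      ... | inj₂ S₂k = Reach-lift _ (Reach-edge (select-∈⁺ E S₂ k S₂k refl))

    collapse-ys : ∀ {F′ : List (Edge n)} → lookup E i ∈ F′ →
      ∀ {a b} → (a , b) ∈ ys → Reach F′ (collapse u a) (collapse u b)
    collapse-ys _ (here refl) = collapse-edge u u here
    collapse-ys i∈F′ (there (here refl)) = collapse-edge u v (bwd i∈F′ here)

  detour⁺ : ∀ S → IsSpanningTree E S → vlookup S i ≡ true → SplitSpanningTree E (S [ i ]≔ false) TT
  detour⁺ S (connected , bridge) Si =
    record { connected = connected′ ; old-bridge = old-bridge ; new-bridge = new-bridge }
    where
    S₀ : Vec Bool (length E)
    S₀ = S [ i ]≔ false
    S⊆S₀+i : ∀ k → vlookup S k ≡ true → k ≡ i ⊎ vlookup S₀ k ≡ true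
    S⊆S₀+i k Sk with k ≟ᶠ i
    ... | yes k≡i = inj₁ k≡i
    ... | no k≢i = inj₂ (trans (lookup∘update′ k≢i S false) Sk)
    connected′ : ∀ x y → Reach (map liftEdge (select E S₀) ++ ys) x y
    connected′ = connected-via (inject₁ u) to-u
      where
      to-u : ∀ x → Reach (map liftEdge (select E S₀) ++ ys) x (inject₁ u)
      to-u x with fromℕ-or-inject₁ x
      ... | inj₁ refl = w-edge u (here refl)
      ... | inj₂ (y , refl) = detour S⊆S₀+i (connected y u)
    old-bridge : ∀ j → vlookup S₀ j ≡ true → ¬ Reach (map liftEdge (select E (S₀ [ j ]≔ false)) ++ ys)
                                                      (inject₁ (proj₁ (lookup E j))) (inject₁ (proj₂ (lookup E j)))
    old-bridge j S₀j r with lookup-removed S i j S₀j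
    ... | j≢i , Sj = bridge j Sj (Reach-collapse _ u S₀-j⊆S-j (collapse-ys i∈S-j) r)
      where
      S₀-j⊆S-j : ∀ {e} → e ∈ select E (S₀ [ j ]≔ false) → e ∈ select E (S [ j ]≔ false)
      S₀-j⊆S-j = select-mono E λ k hk → let k≢j , S₀k = lookup-removed S₀ j k hk
                                      in trans (lookup∘update′ k≢j S false) (proj₂ (lookup-removed S i k S₀k))
      i∈S-j : lookup E i ∈ select E (S [ j ]≔ false)
      i∈S-j = select-∈⁺ E _ i (trans (lookup∘update′ (λ i≡j → j≢i (sym i≡j)) S false) Si) refl
    -- A path from u to w avoiding the edge u w ends with the edge v w, so u and v were joined without i.
    new-bridge : ∀ k → vlookup TT k ≡ true → ¬ Reach (map liftEdge (select E S₀) ++ select ys (TT [ k ]≔ false))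
                                                      (proj₁ (lookup ys k)) (proj₂ (lookup ys k))
    new-bridge F.zero _ r =
      bridge i Si (Reach-collapse _ v (λ e → e) (λ { (here refl) → collapse-edge v v here })
        (Reach-trans r (w-edge v (here refl))))
    new-bridge (F.suc F.zero) _ r =
      bridge i Si (Reach-sym (Reach-collapse _ u (λ e → e) (λ { (here refl) → collapse-edge u u here })
        (Reach-trans r (w-edge u (here refl)))))

  detour⁻-absent : ∀ S → SplitSpanningTree E S TT → vlookup S i ≡ false
  detour⁻-absent S P with vlookup S i in Si
  ... | false = refl
  ... | true = ⊥-elim (SplitSpanningTree.new-bridge P F.zero refl
                 (Reach-trans (Reach-lift _ (Reach-edge (select-∈⁺ E S i Si refl))) (Reach-sym (w-edge v (here refl)))))

  detour⁻ : ∀ S → SplitSpanningTree E S TT → IsSpanningTree E (S [ i ]≔ true)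
  detour⁻ S P = connected′ , bridge
    where
    open SplitSpanningTree P
    S₁ : Vec Bool (length E)
    S₁ = S [ i ]≔ true
    S₁i : vlookup S₁ i ≡ true
    S₁i = lookup∘update i S true
    S⊆S₁ : ∀ k → vlookup S k ≡ true → vlookup S₁ k ≡ true
    S⊆S₁ k Sk with k ≟ᶠ i
    ... | yes refl = S₁i
    ... | no k≢i = trans (lookup∘update′ k≢i S true) Sk
    connected′ : ∀ x y → Reach (select E S₁) x y
    connected′ x y = Reach-collapse _ u (select-mono E S⊆S₁) (collapse-ys (select-∈⁺ E S₁ i S₁i refl)) (connected _ _)
    bridge : EdgesAreBridges E S₁
    bridge j S₁j r with j ≟ᶠ i
    ... | yes refl = new-bridge F.zero refl
          (Reach-trans (Reach-lift _ (subst (λ S′ → Reach (select E S′) u v)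
                                            (remove-insert S i false (detour⁻-absent S P)) r))
                       (Reach-sym (w-edge v (here refl))))
    ... | no j≢i = old-bridge j (trans (sym (lookup∘update′ j≢i S true)) S₁j) (detour S₁-j⊆S-j+i r)
      where
      S₁-j⊆S-j+i : ∀ k → vlookup (S₁ [ j ]≔ false) k ≡ true → k ≡ i ⊎ vlookup (S [ j ]≔ false) k ≡ true
      S₁-j⊆S-j+i k hk with lookup-removed S₁ j k hk | k ≟ᶠ i
      ... | _ | yes k≡i = inj₁ k≡i
      ... | k≢j , S₁k | no k≢i =
        inj₂ (trans (lookup∘update′ k≢j S false) (trans (sym (lookup∘update′ k≢i S true)) S₁k))

module AttachTrees {n : ℕ} (E : List (Edge n)) (i : Fin (length E)) where
  open Attach E i

  onlyᵘ onlyᵛ both : Vec Bool (length E) → Vec Bool (length E⁺)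
  onlyᵘ S = join E S TF
  onlyᵛ S = join E S FT
  both S = join E (S [ i ]≔ false) TT

  containsᵢ : Vec Bool (length E) → Bool
  containsᵢ S = vlookup S i

  -- Every spanning tree of E⁺ keeps w by exactly one new edge or by both, in which case u w v replaces i.
  attachTrees : List (Vec Bool (length E)) → List (Vec Bool (length E⁺))
  attachTrees L = map onlyᵘ L ++ (map onlyᵛ L ++ map both (filterᵇ containsᵢ L))

  private
    containsᵢ-true : ∀ {L S} → S ∈ filterᵇ containsᵢ L → S ∈ L × vlookup S i ≡ true
    containsᵢ-true m with ∈-filter⁻ (λ S → Bool.T? (containsᵢ S)) m
    ... | S∈L , Si = S∈L , Equivalence.to T-≡ Si

  attachTrees-unique : ∀ L → Unique L → Unique (attachTrees L)
  attachTrees-unique L unique = Unique.++⁺ uniqueᵘ (Unique.++⁺ uniqueᵛ uniqueᵇ disjointᵛᵇ) disjointᵘ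
    where
    join-injectiveˡ : ∀ {T S₁ S₂} → join E S₁ T ≡ join E S₂ T → S₁ ≡ S₂
    join-injectiveˡ eq = proj₁ (join-injective E eq)
    TF≢FT : TF ≢ FT
    TF≢FT ()
    TF≢TT : TF ≢ TT
    TF≢TT ()
    FT≢TT : FT ≢ TT
    FT≢TT ()
    uniqueᵘ : Unique (map onlyᵘ L)
    uniqueᵘ = Unique.map⁺ join-injectiveˡ unique
    uniqueᵛ : Unique (map onlyᵛ L)
    uniqueᵛ = Unique.map⁺ join-injectiveˡ unique
    uniqueᵇ : Unique (map both (filterᵇ containsᵢ L))
    uniqueᵇ = Unique-map⁺-on both injective (Unique.filter⁺ _ unique)
      where
      injective : ∀ {S₁ S₂} → S₁ ∈ filterᵇ containsᵢ L → S₂ ∈ filterᵇ containsᵢ L → both S₁ ≡ both S₂ → S₁ ≡ S₂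
      injective {S₁} {S₂} m₁ m₂ eq =
        trans (sym (remove-insert S₁ i true (proj₂ (containsᵢ-true {L} m₁))))
          (trans (cong (_[ i ]≔ true) (join-injectiveˡ eq)) (remove-insert S₂ i true (proj₂ (containsᵢ-true {L} m₂))))
    patterns-differ : ∀ {T₁ T₂ S₁ S₂} → T₁ ≢ T₂ → join E S₁ T₁ ≢ join E S₂ T₂
    patterns-differ T₁≢T₂ eq = T₁≢T₂ (proj₂ (join-injective E eq))
    disjointᵛᵇ : Disjoint (map onlyᵛ L) (map both (filterᵇ containsᵢ L))
    disjointᵛᵇ (m₁ , m₂) with ∈-map⁻ onlyᵛ m₁ | ∈-map⁻ both m₂
    ... | _ , _ , refl | _ , _ , eq = patterns-differ FT≢TT eq
    disjointᵘ : Disjoint (map onlyᵘ L) (map onlyᵛ L ++ map both (filterᵇ containsᵢ L))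
    disjointᵘ (m₁ , m₂) with ∈-map⁻ onlyᵘ m₁ | ∈-++⁻ (map onlyᵛ L) m₂
    ... | _ , _ , refl | inj₁ m with ∈-map⁻ onlyᵛ m
    ... | _ , _ , eq = patterns-differ TF≢FT eq
    disjointᵘ (m₁ , m₂) | _ , _ , refl | inj₂ m with ∈-map⁻ both m
    ... | _ , _ , eq = patterns-differ TF≢TT eq

  attachTrees-complete : ∀ L → (∀ S → (S ∈ L) ⇔ IsSpanningTree E S) →
    ∀ S′ → (S′ ∈ attachTrees L) ⇔ IsSpanningTree E⁺ S′
  attachTrees-complete L complete S′ = mk⇔ to from
    where
    tree : ∀ {S} → S ∈ L → IsSpanningTree E S
    tree {S} = Equivalence.to (complete S)
    listed : ∀ {S} → IsSpanningTree E S → S ∈ L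
    listed {S} = Equivalence.from (complete S)
    to : S′ ∈ attachTrees L → IsSpanningTree E⁺ S′
    to m with ∈-++⁻ (map onlyᵘ L) m
    ... | inj₁ mᵘ with ∈-map⁻ onlyᵘ mᵘ
    ... | S , S∈L , refl = join-spanningTree⁺ E S TF (pendantᵘ⁺ S (tree S∈L))
    to m | inj₂ m′ with ∈-++⁻ (map onlyᵛ L) m′
    ... | inj₁ mᵛ with ∈-map⁻ onlyᵛ mᵛ
    ... | S , S∈L , refl = join-spanningTree⁺ E S FT (pendantᵛ⁺ S (tree S∈L))
    to m | inj₂ m′ | inj₂ mᵇ with ∈-map⁻ both mᵇ
    ... | S , S∈Lᵢ , refl with containsᵢ-true S∈Lᵢ
    ... | S∈L , Si = join-spanningTree⁺ E _ TT (detour⁺ S (tree S∈L) Si)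
    from : IsSpanningTree E⁺ S′ → S′ ∈ attachTrees L
    from t with join-surjective E S′
    ... | S , T , refl with join-spanningTree⁻ E S T t
    from t | S , true ∷ false ∷ [] , refl | P =
      ∈-++⁺ˡ (∈-map⁺ onlyᵘ (listed (Pendant.pendant⁻ u S TF refl P)))
    from t | S , false ∷ true ∷ [] , refl | P =
      ∈-++⁺ʳ (map onlyᵘ L) (∈-++⁺ˡ (∈-map⁺ onlyᵛ (listed (Pendant.pendant⁻ v S FT refl P))))
    from t | S , true ∷ true ∷ [] , refl | P =
      ∈-++⁺ʳ (map onlyᵘ L) (∈-++⁺ʳ (map onlyᵛ L)
        (subst (λ S₀ → join E S₀ TT ∈ map both (filterᵇ containsᵢ L)) (remove-insert S i false (detour⁻-absent S P))
          (∈-map⁺ both (∈-filter⁺ (λ S → Bool.T? (containsᵢ S)) (listed (detour⁻ S P))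
                                  (Equivalence.from T-≡ (lookup∘update i S true))))))
    from t | S , false ∷ false ∷ [] , refl | P = ⊥-elim (w-not-isolated S P)

module AttachIncidence {n : ℕ} (E : List (Edge n)) (i : Fin (length E)) where
  open Attach E i

  deg-w : deg E⁺ w ≡ 2
  deg-w rewrite deg-++ (map liftEdge E) ys w | deg-lift-fromℕ E
              | incident-proj₂ (inject₁ u , w) | incident-proj₂ (inject₁ v , w) = refl

  deg-attach : ∀ y → deg E⁺ (inject₁ y) ≡ deg E y + (𝟙 (does (y ≟ᶠ u)) + (𝟙 (does (y ≟ᶠ v)) + 0))
  deg-attach y rewrite deg-++ (map liftEdge E) ys (inject₁ y) | deg-lift E y
                     | deg-∷ (inject₁ u , w) ((inject₁ v , w) ∷ []) (inject₁ y) | deg-∷ (inject₁ v , w) [] (inject₁ y)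
                     | incident-inject₁-new y u | incident-inject₁-new y v = refl

  deg-attach-away : ∀ y → y ≢ u → y ≢ v → deg E⁺ (inject₁ y) ≡ deg E y
  deg-attach-away y y≢u y≢v rewrite deg-attach y | dec-false (y ≟ᶠ u) y≢u | dec-false (y ≟ᶠ v) y≢v = +-identityʳ _

  deg-attach-mono : ∀ y → deg E y ≤ deg E⁺ (inject₁ y)
  deg-attach-mono y rewrite deg-attach y = m≤m+n _ _

  deg-attach-endpoint : ∀ y → incident y (lookup E i) ≡ true → suc (deg E y) ≤ deg E⁺ (inject₁ y)
  deg-attach-endpoint y inc rewrite deg-attach y with incident⇒endpoint y (lookup E i) inc
  ... | inj₁ refl rewrite dec-true (u ≟ᶠ u) refl = m<m+n (deg E u) (s≤s z≤n)
  ... | inj₂ refl rewrite dec-true (v ≟ᶠ v) refl = m<m+n (deg E v) (m≤n+m 1 _)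

  newᵘ newᵛ : Fin (length E⁺)
  newᵘ = newIx E F.zero
  newᵛ = newIx E (F.suc F.zero)

  incident-w : ∀ j → incident w (lookup E⁺ j) ≡ true → j ≡ newᵘ ⊎ j ≡ newᵛ
  incident-w j inc with oldIx-or-newIx E j
  ... | inj₁ (k , refl) =
    ⊥-elim (false≢true (trans (sym (incident-fromℕ-lift (lookup E k)))
                              (subst (λ e → incident w e ≡ true) (lookup-oldIx E k) inc)))
  ... | inj₂ (F.zero , refl) = inj₁ refl
  ... | inj₂ (F.suc F.zero , refl) = inj₂ refl

  incident-w-newᵘ : incident w (lookup E⁺ newᵘ) ≡ true
  incident-w-newᵘ = subst (λ e → incident w e ≡ true) (sym (lookup-newIx E F.zero)) (incident-proj₂ (inject₁ u , w))

  incident-w-newᵛ : incident w (lookup E⁺ newᵛ) ≡ true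
  incident-w-newᵛ =
    subst (λ e → incident w e ≡ true) (sym (lookup-newIx E (F.suc F.zero))) (incident-proj₂ (inject₁ v , w))

  incident-oldIx : ∀ y j → incident (inject₁ y) (lookup E⁺ (oldIx E j)) ≡ incident y (lookup E j)
  incident-oldIx y j = trans (cong (incident (inject₁ y)) (lookup-oldIx E j)) (incident-lift y (lookup E j))

  private
    new-not-incident : ∀ y k c → y ≢ c → lookup ys k ≡ (inject₁ c , w) →
      incident (inject₁ y) (lookup E⁺ (newIx E k)) ≡ false
    new-not-incident y k c y≢c eq =
      trans (cong (incident (inject₁ y)) (trans (lookup-newIx E k) eq))
            (trans (incident-inject₁-new y c) (dec-false (y ≟ᶠ c) y≢c))

  incident-away : ∀ y → y ≢ u → y ≢ v → ∀ j → incident (inject₁ y) (lookup E⁺ j) ≡ true →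
    ∃[ k ] j ≡ oldIx E k × incident y (lookup E k) ≡ true
  incident-away y y≢u y≢v j inc with oldIx-or-newIx E j
  ... | inj₁ (k , refl) = k , refl , trans (sym (incident-oldIx y k)) inc
  ... | inj₂ (F.zero , refl) = ⊥-elim (false≢true (trans (sym (new-not-incident y F.zero u y≢u refl)) inc))
  ... | inj₂ (F.suc F.zero , refl) =
    ⊥-elim (false≢true (trans (sym (new-not-incident y (F.suc F.zero) v y≢v refl)) inc))

-- Counting spanning trees at the two ends

-- Trees counted by which of the edges p₁ p₂ (at one end) and q₁ q₂ (at the other end) they use.
module EndCensus {N : ℕ} (L : List (Vec Bool N)) (p₁ p₂ q₁ q₂ : Fin N) where

  at : Fin N → Bool → Vec Bool N → Bool
  at j b S = vlookup S j == b

  qClass : Bool → Bool → Vec Bool N → Bool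
  qClass y₁ y₂ S = at q₁ y₁ S ∧ at q₂ y₂ S

  census : Bool → Bool → Bool → Bool → ℕ
  census x₁ x₂ y₁ y₂ = count (λ S → at p₁ x₁ S ∧ (at p₂ x₂ S ∧ qClass y₁ y₂ S)) L

  qMarginal : ∀ y₁ y₂ → count (qClass y₁ y₂) L ≡ Σᵇ (λ x₂ → Σᵇ (λ x₁ → census x₁ x₂ y₁ y₂))
  qMarginal y₁ y₂ = trans (count-by (λ S → vlookup S p₂) _ L)
    (Σᵇ-cong λ x₂ → count-by (λ S → vlookup S p₁) (λ S → at p₂ x₂ S ∧ qClass y₁ y₂ S) L)

  p₁Marginal : ∀ y₁ y₂ → count (λ S → vlookup S p₁ ∧ qClass y₁ y₂ S) L ≡ Σᵇ (λ x₂ → census true x₂ y₁ y₂)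
  p₁Marginal y₁ y₂ = trans (count-by (λ S → vlookup S p₂) _ L)
    (Σᵇ-cong (λ x₂ → count-cong L (λ S → ∧-swapˡ (at p₂ x₂ S) (vlookup S p₁) (qClass y₁ y₂ S))))

  length≡Σcensus : length L ≡ Σᵇ (λ y₂ → Σᵇ (λ y₁ → Σᵇ (λ x₂ → Σᵇ (λ x₁ → census x₁ x₂ y₁ y₂))))
  length≡Σcensus = trans (length≡count L) (trans (count-by (λ S → vlookup S q₂) _ L) (Σᵇ-cong λ y₂ →
    trans (count-cong L (λ S → ∧-identityʳ (at q₂ y₂ S)))
      (trans (count-by (λ S → vlookup S q₁) _ L) (Σᵇ-cong λ y₁ → qMarginal y₁ y₂))))

census-swapₚ : ∀ {N} (L : List (Vec Bool N)) p₁ p₂ q₁ q₂ x₁ x₂ y₁ y₂ →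
  EndCensus.census L p₂ p₁ q₁ q₂ x₁ x₂ y₁ y₂ ≡ EndCensus.census L p₁ p₂ q₁ q₂ x₂ x₁ y₁ y₂
census-swapₚ L p₁ p₂ q₁ q₂ x₁ x₂ y₁ y₂ = count-cong L λ S → ∧-swapˡ (vlookup S p₂ == x₁) (vlookup S p₁ == x₂) _

census-swapₑ : ∀ {N} (L : List (Vec Bool N)) p₁ p₂ q₁ q₂ x₁ x₂ y₁ y₂ →
  EndCensus.census L q₁ q₂ p₁ p₂ x₁ x₂ y₁ y₂ ≡ EndCensus.census L p₁ p₂ q₁ q₂ y₁ y₂ x₁ x₂
census-swapₑ L p₁ p₂ q₁ q₂ x₁ x₂ y₁ y₂ =
  count-cong L λ S → swap-pairs (vlookup S q₁ == x₁) (vlookup S q₂ == x₂) (vlookup S p₁ == y₁) (vlookup S p₂ == y₂)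
  where
  swap-pairs : ∀ a b c d → a ∧ (b ∧ (c ∧ d)) ≡ c ∧ (d ∧ (a ∧ b))
  swap-pairs a b c d = trans (sym (∧-assoc a b (c ∧ d))) (trans (∧-comm (a ∧ b) (c ∧ d)) (∧-assoc c d (a ∧ b)))

data EndUse : Set where
  both one none : EndUse

endUse : Bool → Bool → EndUse
endUse true true = both
endUse true false = one
endUse false true = one
endUse false false = none

endUse-comm : ∀ x₁ x₂ → endUse x₁ x₂ ≡ endUse x₂ x₁
endUse-comm true true = refl
endUse-comm true false = refl
endUse-comm false true = refl
endUse-comm false false = refl

-- The census of a linear 2-tree with k + 2 triangles is table F₂ₖ F₂ₖ₊₁; a spanning tree never avoids
-- both edges at an end, since it would isolate the end vertex.
table : ℕ → ℕ → EndUse → EndUse → ℕ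
table a b none _ = 0
table a b both none = 0
table a b one none = 0
table a b both both = a
table a b both one = b
table a b one both = b
table a b one one = b + a

table-comm : ∀ a b k l → table a b k l ≡ table a b l k
table-comm a b none none = refl
table-comm a b none both = refl
table-comm a b none one = refl
table-comm a b both none = refl
table-comm a b one none = refl
table-comm a b both both = refl
table-comm a b both one = refl
table-comm a b one both = refl
table-comm a b one one = refl

-- Attaching a vertex at p₁ turns the census for (a , b) into the one for (b + a , (b + a) + b).
table-both : ∀ a b l → Σᵇ (λ x₂ → table a b (endUse true x₂) l) ≡ table (b + a) ((b + a) + b) both l
table-both a b none = refl
table-both a b both = +-comm a b
table-both a b one = +-comm b (b + a)

table-one : ∀ a b l → Σᵇ (λ x₂ → Σᵇ (λ x₁ → table a b (endUse x₁ x₂) l)) ≡ table (b + a) ((b + a) + b) one l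
table-one a b none = refl
table-one a b both = lemma a b
  where
  lemma : ∀ a b → (a + b) + (b + 0) ≡ (b + a) + b
  lemma = solve-∀
table-one a b one = lemma a b
  where
  lemma : ∀ a b → (b + (b + a)) + ((b + a) + 0) ≡ ((b + a) + b) + (b + a)
  lemma = solve-∀

module AttachCensus {n : ℕ} (E : List (Edge n)) (i : Fin (length E)) (L : List (Vec Bool (length E)))
    (p₂ q₁ q₂ : Fin (length E)) (i≢q₁ : i ≢ q₁) (i≢q₂ : i ≢ q₂) where
  open Attach E i
  open AttachTrees E i
  open AttachIncidence E i using (newᵘ; newᵛ)
  module Old = EndCensus L i p₂ q₁ q₂
  module New = EndCensus (attachTrees L) newᵘ newᵛ (oldIx E q₁) (oldIx E q₂)

  private
    census-join : ∀ (T : Vec Bool 2) (f : Vec Bool (length E) → Vec Bool (length E))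
      (f-q₁ : ∀ S → vlookup (f S) q₁ ≡ vlookup S q₁) (f-q₂ : ∀ S → vlookup (f S) q₂ ≡ vlookup S q₂) L′ x₁ x₂ y₁ y₂ →
      count (λ S′ → New.at newᵘ x₁ S′ ∧ (New.at newᵛ x₂ S′ ∧ New.qClass y₁ y₂ S′)) (map (λ S → join E (f S) T) L′)
      ≡ count (λ S → (vlookup T F.zero == x₁) ∧ ((vlookup T (F.suc F.zero) == x₂) ∧ Old.qClass y₁ y₂ S)) L′
    census-join T f f-q₁ f-q₂ L′ x₁ x₂ y₁ y₂ = trans (count-map _ _ L′) (count-cong L′ λ S →
      cong₂ _∧_ (cong (_== x₁) (join-newIx E (f S) T F.zero))
        (cong₂ _∧_ (cong (_== x₂) (join-newIx E (f S) T (F.suc F.zero)))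
          (cong₂ _∧_ (cong (_== y₁) (trans (join-oldIx E (f S) T q₁) (f-q₁ S)))
                     (cong (_== y₂) (trans (join-oldIx E (f S) T q₂) (f-q₂ S))))))

    unchanged : ∀ q → i ≢ q → ∀ S → vlookup (S [ i ]≔ false) q ≡ vlookup S q
    unchanged q i≢q S = lookup∘update′ (λ q≡i → i≢q (sym q≡i)) S false

    three-parts : Bool → Bool → Bool → Bool → ℕ
    three-parts x₁ x₂ y₁ y₂ =
      count (λ S → (true == x₁) ∧ ((false == x₂) ∧ Old.qClass y₁ y₂ S)) L
      + (count (λ S → (false == x₁) ∧ ((true == x₂) ∧ Old.qClass y₁ y₂ S)) L
      + count (λ S → vlookup S i ∧ ((true == x₁) ∧ ((true == x₂) ∧ Old.qClass y₁ y₂ S))) L)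

    census-three : ∀ x₁ x₂ y₁ y₂ → New.census x₁ x₂ y₁ y₂ ≡ three-parts x₁ x₂ y₁ y₂
    census-three x₁ x₂ y₁ y₂ =
      trans (count-++ _ (map onlyᵘ L) _) (cong₂ _+_ (census-join TF id (λ _ → refl) (λ _ → refl) L x₁ x₂ y₁ y₂)
        (trans (count-++ _ (map onlyᵛ L) _) (cong₂ _+_ (census-join FT id (λ _ → refl) (λ _ → refl) L x₁ x₂ y₁ y₂)
          (trans (census-join TT (_[ i ]≔ false) (unchanged q₁ i≢q₁) (unchanged q₂ i≢q₂)
                              (filterᵇ containsᵢ L) x₁ x₂ y₁ y₂)
                 (count-filterᵇ _ containsᵢ L)))))

  attach-census : ∀ a b → (∀ x₁ x₂ y₁ y₂ → Old.census x₁ x₂ y₁ y₂ ≡ table a b (endUse x₁ x₂) (endUse y₁ y₂)) →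
    ∀ x₁ x₂ y₁ y₂ → New.census x₁ x₂ y₁ y₂ ≡ table (b + a) ((b + a) + b) (endUse x₁ x₂) (endUse y₁ y₂)
  attach-census a b old x₁ x₂ y₁ y₂ = trans (census-three x₁ x₂ y₁ y₂) (by-pattern x₁ x₂)
    where
    one-end : count (Old.qClass y₁ y₂) L ≡ table (b + a) ((b + a) + b) one (endUse y₁ y₂)
    one-end = trans (Old.qMarginal y₁ y₂)
      (trans (Σᵇ-cong λ x₂ → Σᵇ-cong λ x₁ → old x₁ x₂ y₁ y₂) (table-one a b (endUse y₁ y₂)))
    none-of-L : count (λ _ → false) L ≡ 0
    none-of-L = count-none L (λ _ → refl)
    none-with-i : count (λ S → vlookup S i ∧ false) L ≡ 0
    none-with-i = count-none L (λ S → ∧-zeroʳ (vlookup S i))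
    by-pattern : ∀ x₁ x₂ → three-parts x₁ x₂ y₁ y₂ ≡ table (b + a) ((b + a) + b) (endUse x₁ x₂) (endUse y₁ y₂)
    by-pattern true true = cong₂ _+_ none-of-L (cong₂ _+_ none-of-L
      (trans (Old.p₁Marginal y₁ y₂) (trans (Σᵇ-cong λ x₂ → old true x₂ y₁ y₂) (table-both a b (endUse y₁ y₂)))))
    by-pattern true false = trans (cong₂ _+_ one-end (cong₂ _+_ none-of-L none-with-i)) (+-identityʳ _)
    by-pattern false true = trans (cong₂ _+_ none-of-L (cong₂ _+_ one-end none-with-i)) (+-identityʳ _)
    by-pattern false false = cong₂ _+_ none-of-L (cong₂ _+_ none-of-L none-with-i)

record Census (k : ℕ) (E : List (Edge (4 + k))) : Set where
  field
    trees : List (Vec Bool (length E))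
    trees-listed : SpanningTreeList E trees
    end₁ end₂ : Fin (4 + k)
    p₁ p₂ q₁ q₂ : Fin (length E)
    p₁≢q₁ : p₁ ≢ q₁
    p₁≢q₂ : p₁ ≢ q₂
    p₂≢q₁ : p₂ ≢ q₁
    p₂≢q₂ : p₂ ≢ q₂
    deg-end₁ : deg E end₁ ≡ 2
    deg-end₂ : deg E end₂ ≡ 2
    deg-inner : ∀ y → y ≡ end₁ ⊎ y ≡ end₂ ⊎ 3 ≤ deg E y
    at-end₁ : ∀ j → incident end₁ (lookup E j) ≡ true → j ≡ p₁ ⊎ j ≡ p₂
    p₁-at-end₁ : incident end₁ (lookup E p₁) ≡ true
    p₂-at-end₁ : incident end₁ (lookup E p₂) ≡ true
    at-end₂ : ∀ j → incident end₂ (lookup E j) ≡ true → j ≡ q₁ ⊎ j ≡ q₂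
    q₁-at-end₂ : incident end₂ (lookup E q₁) ≡ true
    q₂-at-end₂ : incident end₂ (lookup E q₂) ≡ true
    census : ∀ x₁ x₂ y₁ y₂ → EndCensus.census trees p₁ p₂ q₁ q₂ x₁ x₂ y₁ y₂
                             ≡ table (fib (2 * k)) (fib (suc (2 * k))) (endUse x₁ x₂) (endUse y₁ y₂)

module _ {k : ℕ} {E : List (Edge (4 + k))} where

  swap-p : Census k E → Census k E
  swap-p C = record
    { trees = trees ; trees-listed = trees-listed ; end₁ = end₁ ; end₂ = end₂
    ; p₁ = p₂ ; p₂ = p₁ ; q₁ = q₁ ; q₂ = q₂
    ; p₁≢q₁ = p₂≢q₁ ; p₁≢q₂ = p₂≢q₂ ; p₂≢q₁ = p₁≢q₁ ; p₂≢q₂ = p₁≢q₂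
    ; deg-end₁ = deg-end₁ ; deg-end₂ = deg-end₂ ; deg-inner = deg-inner
    ; at-end₁ = λ j inc → Data.Sum.swap (at-end₁ j inc) ; p₁-at-end₁ = p₂-at-end₁ ; p₂-at-end₁ = p₁-at-end₁
    ; at-end₂ = at-end₂ ; q₁-at-end₂ = q₁-at-end₂ ; q₂-at-end₂ = q₂-at-end₂
    ; census = λ x₁ x₂ y₁ y₂ → trans (census-swapₚ trees p₁ p₂ q₁ q₂ x₁ x₂ y₁ y₂)
                                  (trans (census x₂ x₁ y₁ y₂) (cong (λ t → table _ _ t _) (endUse-comm x₂ x₁)))
    }
    where open Census C

  swap-ends : Census k E → Census k E
  swap-ends C = record
    { trees = trees ; trees-listed = trees-listed ; end₁ = end₂ ; end₂ = end₁
    ; p₁ = q₁ ; p₂ = q₂ ; q₁ = p₁ ; q₂ = p₂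
    ; p₁≢q₁ = λ eq → p₁≢q₁ (sym eq) ; p₁≢q₂ = λ eq → p₂≢q₁ (sym eq)
    ; p₂≢q₁ = λ eq → p₁≢q₂ (sym eq) ; p₂≢q₂ = λ eq → p₂≢q₂ (sym eq)
    ; deg-end₁ = deg-end₂ ; deg-end₂ = deg-end₁ ; deg-inner = λ y → swap-first (deg-inner y)
    ; at-end₁ = at-end₂ ; p₁-at-end₁ = q₁-at-end₂ ; p₂-at-end₁ = q₂-at-end₂
    ; at-end₂ = at-end₁ ; q₁-at-end₂ = p₁-at-end₁ ; q₂-at-end₂ = p₂-at-end₁
    ; census = λ x₁ x₂ y₁ y₂ → trans (census-swapₑ trees p₁ p₂ q₁ q₂ x₁ x₂ y₁ y₂)
                                  (trans (census y₁ y₂ x₁ x₂) (table-comm _ _ (endUse y₁ y₂) (endUse x₁ x₂)))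
    }
    where
    open Census C
    swap-first : ∀ {A B C : Set} → A ⊎ B ⊎ C → B ⊎ A ⊎ C
    swap-first (inj₁ a) = inj₂ (inj₁ a)
    swap-first (inj₂ (inj₁ b)) = inj₁ b
    swap-first (inj₂ (inj₂ c)) = inj₂ (inj₂ c)

census-attach : ∀ {k} {E : List (Edge (4 + k))} (C : Census k E) → Census (suc k) (Attach.E⁺ E (Census.p₁ C))
census-attach {k} {E} C = record
  { trees = attachTrees trees
  ; trees-listed = attachTrees-unique trees (proj₁ trees-listed) , attachTrees-complete trees (proj₂ trees-listed)
  ; end₁ = w ; end₂ = inject₁ end₂
  ; p₁ = newᵘ ; p₂ = newᵛ ; q₁ = oldIx E q₁ ; q₂ = oldIx E q₂
  ; p₁≢q₁ = λ eq → oldIx≢newIx E q₁ F.zero (sym eq)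
  ; p₁≢q₂ = λ eq → oldIx≢newIx E q₂ F.zero (sym eq)
  ; p₂≢q₁ = λ eq → oldIx≢newIx E q₁ (F.suc F.zero) (sym eq)
  ; p₂≢q₂ = λ eq → oldIx≢newIx E q₂ (F.suc F.zero) (sym eq)
  ; deg-end₁ = deg-w
  ; deg-end₂ = trans (deg-attach-away end₂ end₂≢u end₂≢v) deg-end₂
  ; deg-inner = deg-inner⁺
  ; at-end₁ = incident-w ; p₁-at-end₁ = incident-w-newᵘ ; p₂-at-end₁ = incident-w-newᵛ
  ; at-end₂ = at-end₂⁺
  ; q₁-at-end₂ = trans (incident-oldIx end₂ q₁) q₁-at-end₂
  ; q₂-at-end₂ = trans (incident-oldIx end₂ q₂) q₂-at-end₂
  ; census = census⁺
  }
  where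
  open Census C
  open Attach E p₁
  open AttachTrees E p₁
  open AttachIncidence E p₁

  p₁-away-from-end₂ : incident end₂ (lookup E p₁) ≢ true
  p₁-away-from-end₂ inc with at-end₂ p₁ inc
  ... | inj₁ p₁≡q₁ = p₁≢q₁ p₁≡q₁
  ... | inj₂ p₁≡q₂ = p₁≢q₂ p₁≡q₂

  end₂≢u : end₂ ≢ u
  end₂≢u refl = p₁-away-from-end₂ (incident-proj₁ (lookup E p₁))

  end₂≢v : end₂ ≢ v
  end₂≢v refl = p₁-away-from-end₂ (incident-proj₂ (lookup E p₁))

  deg-inner⁺ : ∀ y → y ≡ w ⊎ y ≡ inject₁ end₂ ⊎ 3 ≤ deg E⁺ y
  deg-inner⁺ y with fromℕ-or-inject₁ y
  ... | inj₁ y≡w = inj₁ y≡w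
  ... | inj₂ (z , refl) with deg-inner z
  ... | inj₁ refl =
    inj₂ (inj₂ (subst (λ d → suc d ≤ deg E⁺ (inject₁ end₁)) deg-end₁ (deg-attach-endpoint end₁ p₁-at-end₁)))
  ... | inj₂ (inj₁ refl) = inj₂ (inj₁ refl)
  ... | inj₂ (inj₂ 3≤deg) = inj₂ (inj₂ (≤-trans 3≤deg (deg-attach-mono z)))

  at-end₂⁺ : ∀ j → incident (inject₁ end₂) (lookup E⁺ j) ≡ true → j ≡ oldIx E q₁ ⊎ j ≡ oldIx E q₂
  at-end₂⁺ j inc with incident-away end₂ end₂≢u end₂≢v j inc
  ... | k , refl , inc₀ with at-end₂ k inc₀
  ... | inj₁ refl = inj₁ refl
  ... | inj₂ refl = inj₂ refl

  census⁺ : ∀ x₁ x₂ y₁ y₂ → EndCensus.census (attachTrees trees) newᵘ newᵛ (oldIx E q₁) (oldIx E q₂) x₁ x₂ y₁ y₂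
                            ≡ table (fib (2 * suc k)) (fib (suc (2 * suc k))) (endUse x₁ x₂) (endUse y₁ y₂)
  census⁺ x₁ x₂ y₁ y₂ =
    trans (AttachCensus.attach-census E p₁ trees p₂ q₁ q₂ p₁≢q₁ p₁≢q₂ _ _ census x₁ x₂ y₁ y₂)
          (cong₂ (λ a b → table a b (endUse x₁ x₂) (endUse y₁ y₂))
                 (sym (cong fib (*-suc 2 k))) (sym (cong (λ m → fib (suc m)) (*-suc 2 k))))

-- The triangle and its three extensions

module Triangle where

  pattern t = true
  pattern f = false

  v₀ v₁ v₂ : Fin 3
  v₀ = F.zero
  v₁ = F.suc F.zero
  v₂ = F.suc (F.suc F.zero)

  E₃ : List (Edge 3)
  E₃ = (v₀ , v₁) ∷ (v₁ , v₂) ∷ (v₀ , v₂) ∷ []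

  trees₃ : List (Vec Bool 3)
  trees₃ = (t ∷ t ∷ f ∷ []) ∷ (t ∷ f ∷ t ∷ []) ∷ (f ∷ t ∷ t ∷ []) ∷ []

  private
    connected₃ : ∀ {G : List (Edge 3)} → Reach G v₁ v₀ → Reach G v₂ v₀ → ∀ x y → Reach G x y
    connected₃ {G} r₁ r₂ = connected-via v₀ to-v₀
      where
      to-v₀ : ∀ x → Reach G x v₀
      to-v₀ F.zero = here
      to-v₀ (F.suc F.zero) = r₁
      to-v₀ (F.suc (F.suc F.zero)) = r₂

    single : ∀ {a b : Fin 3} (z : Fin 3) → does (a ≟ᶠ z) ≡ does (b ≟ᶠ z) →
      ∀ {c d} → (c , d) ∈ (a , b) ∷ [] → does (c ≟ᶠ z) ≡ does (d ≟ᶠ z)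
    single z eq (here refl) = eq

    tree-ttf : IsSpanningTree E₃ (t ∷ t ∷ f ∷ [])
    tree-ttf = connected₃ r₁ (bwd (there (here refl)) r₁) , bridge
      where
      r₁ : Reach (select E₃ (t ∷ t ∷ f ∷ [])) v₁ v₀
      r₁ = bwd (here refl) here
      bridge : EdgesAreBridges E₃ (t ∷ t ∷ f ∷ [])
      bridge F.zero _ = separated v₀ (single v₀ refl) (λ ())
      bridge (F.suc F.zero) _ = separated v₂ (single v₂ refl) (λ ())
      bridge (F.suc (F.suc F.zero)) ()

    tree-tft : IsSpanningTree E₃ (t ∷ f ∷ t ∷ [])
    tree-tft = connected₃ (bwd (here refl) here) (bwd (there (here refl)) here) , bridge
      where
      bridge : EdgesAreBridges E₃ (t ∷ f ∷ t ∷ [])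
      bridge F.zero _ = separated v₁ (single v₁ refl) (λ ())
      bridge (F.suc F.zero) ()
      bridge (F.suc (F.suc F.zero)) _ = separated v₂ (single v₂ refl) (λ ())

    tree-ftt : IsSpanningTree E₃ (f ∷ t ∷ t ∷ [])
    tree-ftt = connected₃ (fwd (here refl) r₂) r₂ , bridge
      where
      r₂ : Reach (select E₃ (f ∷ t ∷ t ∷ [])) v₂ v₀
      r₂ = bwd (there (here refl)) here
      bridge : EdgesAreBridges E₃ (f ∷ t ∷ t ∷ [])
      bridge F.zero ()
      bridge (F.suc F.zero) _ = separated v₁ (single v₁ refl) (λ ())
      bridge (F.suc (F.suc F.zero)) _ = separated v₀ (single v₀ refl) (λ ())

    not-listed : ∀ {A : Set} {S} → S ≢ t ∷ t ∷ f ∷ [] → S ≢ t ∷ f ∷ t ∷ [] → S ≢ f ∷ t ∷ t ∷ [] → S ∈ trees₃ → A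
    not-listed ≢₁ _ _ (here eq) = ⊥-elim (≢₁ eq)
    not-listed _ ≢₂ _ (there (here eq)) = ⊥-elim (≢₂ eq)
    not-listed _ _ ≢₃ (there (there (here eq))) = ⊥-elim (≢₃ eq)

  -- The remaining edge sets are disconnected, or (all three edges) contain a cycle.
  trees₃-listed : SpanningTreeList E₃ trees₃
  trees₃-listed = ((λ ()) ∷ (λ ()) ∷ []) ∷ ((λ ()) ∷ []) ∷ [] ∷ [] , complete
    where
    complete : ∀ S → (S ∈ trees₃) ⇔ IsSpanningTree E₃ S
    complete (t ∷ t ∷ f ∷ []) = mk⇔ (λ _ → tree-ttf) (λ _ → here refl)
    complete (t ∷ f ∷ t ∷ []) = mk⇔ (λ _ → tree-tft) (λ _ → there (here refl))
    complete (f ∷ t ∷ t ∷ []) = mk⇔ (λ _ → tree-ftt) (λ _ → there (there (here refl)))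
    complete (f ∷ f ∷ f ∷ []) = mk⇔ (not-listed (λ ()) (λ ()) (λ ()))
      (λ tree → ⊥-elim (separated v₀ (λ ()) (λ ()) (proj₁ tree v₀ v₁)))
    complete (t ∷ f ∷ f ∷ []) = mk⇔ (not-listed (λ ()) (λ ()) (λ ()))
      (λ tree → ⊥-elim (separated v₂ (single v₂ refl) (λ ()) (proj₁ tree v₀ v₂)))
    complete (f ∷ t ∷ f ∷ []) = mk⇔ (not-listed (λ ()) (λ ()) (λ ()))
      (λ tree → ⊥-elim (separated v₀ (single v₀ refl) (λ ()) (proj₁ tree v₀ v₁)))
    complete (f ∷ f ∷ t ∷ []) = mk⇔ (not-listed (λ ()) (λ ()) (λ ()))
      (λ tree → ⊥-elim (separated v₁ (single v₁ refl) (λ ()) (proj₁ tree v₀ v₁)))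
    complete (t ∷ t ∷ t ∷ []) = mk⇔ (not-listed (λ ()) (λ ()) (λ ()))
      (λ tree → ⊥-elim (proj₂ tree F.zero refl (fwd (there (here refl)) (bwd (here refl) here))))

module CensusByDecision (E : List (Edge 4)) (trees : List (Vec Bool (length E))) (end₁ end₂ : Fin 4)
    (p₁ p₂ q₁ q₂ : Fin (length E)) where

  EndsAt : Fin 4 → Fin (length E) → Fin (length E) → Set
  EndsAt y e₁ e₂ = deg E y ≡ 2 × (∀ j → incident y (lookup E j) ≡ true → j ≡ e₁ ⊎ j ≡ e₂)
                   × incident y (lookup E e₁) ≡ true × incident y (lookup E e₂) ≡ true

  endsAt? : ∀ y e₁ e₂ → Dec (EndsAt y e₁ e₂)
  endsAt? y e₁ e₂ = (deg E y ℕ.≟ 2)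
    ×-dec all? (λ j → (incident y (lookup E j) Bool.≟ true) →-dec ((j ≟ᶠ e₁) ⊎-dec (j ≟ᶠ e₂)))
    ×-dec (incident y (lookup E e₁) Bool.≟ true) ×-dec (incident y (lookup E e₂) Bool.≟ true)

  Checks : Set
  Checks = (p₁ ≢ q₁ × p₁ ≢ q₂ × p₂ ≢ q₁ × p₂ ≢ q₂)
    × EndsAt end₁ p₁ p₂ × EndsAt end₂ q₁ q₂ × (∀ y → y ≡ end₁ ⊎ y ≡ end₂ ⊎ 3 ≤ deg E y)
    × (∀ x₁ x₂ y₁ y₂ → EndCensus.census trees p₁ p₂ q₁ q₂ x₁ x₂ y₁ y₂ ≡ table 0 1 (endUse x₁ x₂) (endUse y₁ y₂))

  checks? : Dec Checks
  checks? = (¬? (p₁ ≟ᶠ q₁) ×-dec ¬? (p₁ ≟ᶠ q₂) ×-dec ¬? (p₂ ≟ᶠ q₁) ×-dec ¬? (p₂ ≟ᶠ q₂))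
    ×-dec endsAt? end₁ p₁ p₂ ×-dec endsAt? end₂ q₁ q₂
    ×-dec all? (λ y → (y ≟ᶠ end₁) ⊎-dec (y ≟ᶠ end₂) ⊎-dec (3 ℕ.≤? deg E y))
    ×-dec ∀-Bool? λ x₁ → ∀-Bool? λ x₂ → ∀-Bool? λ y₁ → ∀-Bool? λ y₂ →
            EndCensus.census trees p₁ p₂ q₁ q₂ x₁ x₂ y₁ y₂ ℕ.≟ table 0 1 (endUse x₁ x₂) (endUse y₁ y₂)

  census-by-decision : SpanningTreeList E trees → True checks? → Census 0 E
  census-by-decision listed ok with toWitness ok
  ... | (p₁≢q₁ , p₁≢q₂ , p₂≢q₁ , p₂≢q₂) , (deg-end₁ , at-end₁ , p₁-at-end₁ , p₂-at-end₁)
      , (deg-end₂ , at-end₂ , q₁-at-end₂ , q₂-at-end₂) , deg-inner , census = record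
    { trees = trees ; trees-listed = listed ; end₁ = end₁ ; end₂ = end₂ ; p₁ = p₁ ; p₂ = p₂ ; q₁ = q₁ ; q₂ = q₂
    ; p₁≢q₁ = p₁≢q₁ ; p₁≢q₂ = p₁≢q₂ ; p₂≢q₁ = p₂≢q₁ ; p₂≢q₂ = p₂≢q₂
    ; deg-end₁ = deg-end₁ ; deg-end₂ = deg-end₂ ; deg-inner = deg-inner
    ; at-end₁ = at-end₁ ; p₁-at-end₁ = p₁-at-end₁ ; p₂-at-end₁ = p₂-at-end₁
    ; at-end₂ = at-end₂ ; q₁-at-end₂ = q₁-at-end₂ ; q₂-at-end₂ = q₂-at-end₂
    ; census = census
    }

-- The vertex of the triangle opposite to its edge i, and the two edges at it.
opposite : Fin 3 → Fin 4
opposite F.zero = F.# 2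
opposite (F.suc F.zero) = F.# 0
opposite (F.suc (F.suc F.zero)) = F.# 1

opposite-edges : Fin 3 → Fin 5 × Fin 5
opposite-edges F.zero = F.# 1 , F.# 2
opposite-edges (F.suc F.zero) = F.# 0 , F.# 2
opposite-edges (F.suc (F.suc F.zero)) = F.# 0 , F.# 1

module TriangleAttached (i : Fin 3) where
  open Triangle
  open AttachTrees E₃ i

  open CensusByDecision (Attach.E⁺ E₃ i) (attachTrees trees₃) (F.# 3) (opposite i)
    (F.# 3) (F.# 4) (proj₁ (opposite-edges i)) (proj₂ (opposite-edges i)) public

  listed : SpanningTreeList (Attach.E⁺ E₃ i) (attachTrees trees₃)
  listed = attachTrees-unique trees₃ (proj₁ trees₃-listed) , attachTrees-complete trees₃ (proj₂ trees₃-listed)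

census₀ : (i : Fin 3) → Census 0 (Attach.E⁺ Triangle.E₃ i)
census₀ F.zero = TriangleAttached.census-by-decision F.zero (TriangleAttached.listed F.zero) _
census₀ (F.suc F.zero) = TriangleAttached.census-by-decision (F.# 1) (TriangleAttached.listed (F.# 1)) _
census₀ (F.suc (F.suc F.zero)) = TriangleAttached.census-by-decision (F.# 2) (TriangleAttached.listed (F.# 2)) _

-- Linear 2-trees

no-linear2Tree-below-3 : ∀ {n E} → n ≤ 2 → ¬ Linear2Tree n E
no-linear2Tree-below-3 (s≤s (s≤s ())) triangle
no-linear2Tree-below-3 (s≤s n≤1) (extend l _ _) = no-linear2Tree-below-3 (≤-trans n≤1 (m≤n+m 1 1)) l

degree-two-endpoint : ∀ {n} (E : List (Edge n)) i → (deg E (proj₁ (lookup E i)) ≡ 2 ⊎ deg E (proj₂ (lookup E i)) ≡ 2) →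
  ∃[ y ] deg E y ≡ 2 × incident y (lookup E i) ≡ true
degree-two-endpoint E i (inj₁ deg₁) = _ , deg₁ , incident-proj₁ (lookup E i)
degree-two-endpoint E i (inj₂ deg₂) = _ , deg₂ , incident-proj₂ (lookup E i)

module _ {k : ℕ} {E : List (Edge (4 + k))} where

  census-attach-at-end₁ : (C : Census k E) (i : Fin (length E)) → incident (Census.end₁ C) (lookup E i) ≡ true →
    Census (suc k) (Attach.E⁺ E i)
  census-attach-at-end₁ C i inc with Census.at-end₁ C i inc
  ... | inj₁ refl = census-attach C
  ... | inj₂ refl = census-attach (swap-p C)

  -- A degree-two endpoint of i can only be one of the two ends.
  census-extend : Census k E → (i : Fin (length E)) →
    (deg E (proj₁ (lookup E i)) ≡ 2 ⊎ deg E (proj₂ (lookup E i)) ≡ 2) → Census (suc k) (Attach.E⁺ E i)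
  census-extend C i deg-two with degree-two-endpoint E i deg-two
  ... | y , deg-y , inc with Census.deg-inner C y
  ... | inj₁ refl = census-attach-at-end₁ C i inc
  ... | inj₂ (inj₁ refl) = census-attach-at-end₁ (swap-ends C) i inc
  ... | inj₂ (inj₂ 3≤deg) = ⊥-elim (3≰2 (subst (3 ≤_) deg-y 3≤deg))
    where
    3≰2 : ¬ 3 ≤ 2
    3≰2 (s≤s (s≤s ()))

linear2Tree-census : ∀ k {E : List (Edge (4 + k))} → Linear2Tree (4 + k) E → Census k E
linear2Tree-census zero (extend triangle i _) = census₀ i
linear2Tree-census zero (extend (extend l _ _) _ _) = ⊥-elim (no-linear2Tree-below-3 ≤-refl l)
linear2Tree-census (suc k) (extend l i deg-two) = census-extend (linear2Tree-census k l) i deg-two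

-- Summing the census over one end advances the Fibonacci pair by two steps, summing over the other
-- end by two more; the one remaining entry is F₂ₖ₊₆ by definition of fib.
census-total : ∀ {k E} (C : Census k E) → length (Census.trees C) ≡ fib (6 + 2 * k)
census-total {k} C = begin
  length trees
    ≡⟨ length≡Σcensus ⟩
  Σᵇ (λ y₂ → Σᵇ (λ y₁ → Σᵇ (λ x₂ → Σᵇ (λ x₁ → census x₁ x₂ y₁ y₂))))
    ≡⟨ Σᵇ-cong (λ y₂ → Σᵇ-cong λ y₁ → trans (Σᵇ-cong λ x₂ → Σᵇ-cong λ x₁ → Census.census C x₁ x₂ y₁ y₂)
                                             (table-one a b (endUse y₁ y₂))) ⟩
  Σᵇ (λ y₂ → Σᵇ (λ y₁ → table (b + a) ((b + a) + b) one (endUse y₁ y₂)))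
    ≡⟨ Σᵇ-cong (λ y₂ → Σᵇ-cong λ y₁ → table-comm (b + a) ((b + a) + b) one (endUse y₁ y₂)) ⟩
  Σᵇ (λ y₂ → Σᵇ (λ y₁ → table (b + a) ((b + a) + b) (endUse y₁ y₂) one))
    ≡⟨ table-one (b + a) ((b + a) + b) one ⟩
  fib (6 + 2 * k) ∎
  where
  open ≡-Reasoning
  open Census C using (trees; p₁; p₂; q₁; q₂)
  open EndCensus trees p₁ p₂ q₁ q₂
  a b : ℕ
  a = fib (2 * k)
  b = fib (suc (2 * k))

theorem7p5 : (m : ℕ) → 1 ≤ m → (E : List (Edge (suc (suc m)))) →
    Linear2Tree (suc (suc m)) E → NumSpanningTrees E (fib (2 * m + 2))
theorem7p5 (suc zero) _ _ triangle =
  Triangle.trees₃ , proj₁ Triangle.trees₃-listed , refl , proj₂ Triangle.trees₃-listed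
theorem7p5 (suc zero) _ _ (extend l _ _) = ⊥-elim (no-linear2Tree-below-3 ≤-refl l)
theorem7p5 (suc (suc k)) _ E l =
  trees , proj₁ trees-listed , trans (census-total C) (cong fib (sym (index k))) , proj₂ trees-listed
  where
  C : Census k E
  C = linear2Tree-census k l
  open Census C using (trees; trees-listed)
  index : ∀ k → 2 * suc (suc k) + 2 ≡ 6 + 2 * k
  index k = trans (+-comm (2 * suc (suc k)) 2) (cong (2 +_) (trans (*-suc 2 (suc k)) (cong (2 +_) (*-suc 2 k))))
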